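{- Let $k$ be a positive integer and $n\ge0$ an integer. Let $M_k(n)$ denote the number of partitions of $n$ whose minimal excludant is $k$ and in which the number of parts larger than $k$ is greater than the number of parts smaller than $k$. Then $M_k(n)$ equals the number of partitions $\lambda=(\lambda_1,\dots,\lambda_t)$ of $n-\binom{k}{2}$ having a $-1$-fixed hook arising from a part of size $k$, i.e. for which there is $s$ with $1\le s\le t$, $h_{s,1}(\lambda)=s-1$ and $\lambda_s=k$.
   Context: A partition $\lambda=(\lambda_1,\dots,\lambda_t)$ is a nonincreasing sequence of positive integers. First-column hook lengths: $h_{s,1}(\lambda)=\lambda_s+t-s$ for $1\le s\le t$. The minimal excludant (mex) of a partition is the smallest positive integer not occurring as a part. Parts are counted with multiplicity. There are no partitions of a negative integer. -}

module Defs where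

open import Data.Bool using (Bool; true; false; _∧_; not; T)
open import Data.Nat using (ℕ; suc; _+_; _∸_; _<ᵇ_; _≡ᵇ_; _≤ᵇ_)
open import Data.Nat.Combinatorics using (_C_)
open import Data.List using (List; []; _∷_; length; filterᵇ; lookup; allFin; upTo)
open import Data.Bool.ListAction using (all; any)
open import Data.Nat.ListAction using (sum)
open import Data.Fin using (Fin; toℕ)
open import Data.Product using (Σ)

nonincreasing : List ℕ → Bool
nonincreasing []           = true
nonincreasing (x ∷ [])     = true
nonincreasing (x ∷ y ∷ l)  = (y ≤ᵇ x) ∧ nonincreasing (y ∷ l)

isPartition : List ℕ → Bool
isPartition l = nonincreasing l ∧ all (λ x → 1 ≤ᵇ x) l

isPartitionOf : ℕ → List ℕ → Bool
isPartitionOf n l = isPartition l ∧ (sum l ≡ᵇ n)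

occurs : ℕ → List ℕ → Bool
occurs j l = any (λ x → x ≡ᵇ j) l

mexIs : List ℕ → ℕ → Bool
mexIs l k = (1 ≤ᵇ k) ∧ (not (occurs k l) ∧ all (λ j → occurs (suc j) l) (upTo (k ∸ 1)))

#partsLarger : ℕ → List ℕ → ℕ
#partsLarger k l = length (filterᵇ (λ x → k <ᵇ x) l)

#partsSmaller : ℕ → List ℕ → ℕ
#partsSmaller k l = length (filterᵇ (λ x → x <ᵇ k) l)

-- First-column hook length h_{s,1}(λ) = λ_s + t - s, where s = toℕ i + 1
-- (1-indexed) and t = length λ.
hook1 : (l : List ℕ) → Fin (length l) → ℕ
hook1 l i = lookup l i + (length l ∸ suc (toℕ i))

hasMinusOneFixedHookOfSize : ℕ → List ℕ → Bool
hasMinusOneFixedHookOfSize k l =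
  any (λ i → (hook1 l i ≡ᵇ toℕ i) ∧ (lookup l i ≡ᵇ k)) (allFin (length l))

MSet : ℕ → ℕ → Set
MSet k n = Σ (List ℕ) λ l →
  T (isPartitionOf n l ∧ (mexIs l k ∧ (#partsSmaller k l <ᵇ #partsLarger k l)))

-- Partitions of n - binom(k,2) with a (-1)-fixed hook from a part of size k.
-- "Partition of n - binom(k,2)" is encoded as sum λ + binom(k,2) = n,
-- so there are none when n < binom(k,2).
HookSet : ℕ → ℕ → Set
HookSet k n = Σ (List ℕ) λ l →
  T (isPartition l ∧ ((sum l + k C 2 ≡ᵇ n) ∧ hasMinusOneFixedHookOfSize k l))

{-# OPTIONS --safe #-}
module Submission where

-- Write k = suc j.  Both sides are parametrised by the same pairs (A , D) of
-- partitions (Core): the parts of A are at least k, those of D lie in [1, j],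
-- length D + k ≤ length A, and length A + sum A + C(k,2) + sum D = n.
-- A partition with mex k is A + 1 (the parts above k) followed by D with one
-- extra part of each size 1, …, j merged in: mex = k says precisely that the parts
-- below k contain this staircase, which contributes C(k,2), and having more parts
-- above k than below becomes length D + j < length A.
-- A partition with a (−1)-fixed hook at a part k in row s is A, k, B with B equal
-- to D + 1 padded with ones to length (length A ∸ k): the first-column hook in row s
-- is k + length B, and it is (−1)-fixed exactly when s − 1 = length A = k + length B.

open import Defs
open import Data.Nat using (ℕ; _≤_)
open import Function.Bundles using (_↔_)

open import Data.Bool using (Bool; true; false; T; not; _∧_)
open import Data.Bool.ListAction using (all)
open import Data.Bool.Properties using (T-∧; T-irrelevant)
open import Data.Empty using (⊥-elim)
open import Data.Fin using (Fin; toℕ) renaming (zero to fzero; suc to fsuc)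
open import Data.List using (List; []; _∷_; upTo; filterᵇ; _++_; length; map; replicate; take; drop; lookup; allFin; takeWhile; dropWhile)
open import Data.List.Properties using (++-identityʳ; length-++; length-replicate; length-map; map-∘; map-id; takeWhile++dropWhile; filter-++; filter-all; filter-none)
open import Data.List.Membership.Propositional using (_∈_; _∉_)
open import Data.List.Membership.Propositional.Properties using (∈-++⁺ʳ; ∈-++⁻; ∈-allFin)
open import Data.List.Relation.Unary.All as All using (All; []; _∷_)
open import Data.List.Relation.Unary.All.Properties as All using (¬Any⇒All¬; all⁺; all⁻; applyUpTo⁺₁; applyUpTo⁻; all-takeWhile; takeWhile⁺; dropWhile⁺)
open import Data.List.Relation.Unary.AllPairs as AllPairs using (AllPairs; []; _∷_)
import Data.List.Relation.Unary.AllPairs.Properties as AllPairs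
open import Data.List.Relation.Unary.Any as Any using (here; there)
open import Data.List.Relation.Unary.Any.Properties using (any⁺; any⁻)
open import Data.List.Relation.Unary.Linked using (Linked; []; [-]; _∷_)
open import Data.List.Relation.Unary.Linked.Properties using (AllPairs⇒Linked; Linked⇒AllPairs)
open import Data.Nat using (zero; suc; pred; _+_; _∸_; _<_; _≥_; _<ᵇ_; _≤ᵇ_; _≡ᵇ_; ⌊_/2⌋; z≤n; s≤s)
open import Data.Nat.Combinatorics using (_C_; nC1≡n; nCk+nC[k+1]≡[n+1]C[k+1])
open import Data.Nat.ListAction using (sum)
open import Data.Nat.ListAction.Properties using (sum-++)
open import Data.Nat.Properties
open import Algebra.Properties.CommutativeSemigroup +-commutativeSemigroup using (x∙yz≈y∙xz)
open import Data.Nat.Tactic.RingSolver using (solve-∀)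
open import Data.Product using (Σ; ∃₂; _×_; _,_; proj₁; proj₂; uncurry)
open import Data.Product.Function.NonDependent.Propositional using (_×-⇔_)
open import Data.Product.Properties using (Σ-≡,≡→≡)
open import Data.Sum using (inj₁; inj₂)
open import Function using (_∘_; flip)
open import Function.Bundles using (_⇔_; mk⇔; Equivalence; mk↔ₛ′)
open import Function.Construct.Composition using (_⇔-∘_)
open import Relation.Binary.PropositionalEquality using (_≡_; refl; sym; trans; cong; cong₂; subst; subst₂; module ≡-Reasoning)
open import Relation.Nullary using (¬_; yes; no)
open import Relation.Nullary.Decidable using (T?)
open import Relation.Unary using (Decidable)

open ≡-Reasoning

record Parametrisation {X C : Set} (valid : X → Bool) (Param : C → Set) : Set where
  field
    encode : C → X
    decode : X → C
    decode-sound : ∀ {x} → T (valid x) → Param (decode x) × encode (decode x) ≡ x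
    encode-sound : ∀ {c} → Param c → T (valid (encode c)) × decode (encode c) ≡ c

Σ-T-≡ : ∀ {X : Set} {p : X → Bool} {x y : X} {px : T (p x)} {py : T (p y)} →
        x ≡ y → _≡_ {A = Σ X (T ∘ p)} (x , px) (y , py)
Σ-T-≡ refl = Σ-≡,≡→≡ (refl , T-irrelevant _ _)

↔-byCommonParametrisation :
  ∀ {X Y C : Set} {p : X → Bool} {q : Y → Bool} {Param : C → Set} →
  Parametrisation p Param → Parametrisation q Param → Σ X (λ x → T (p x)) ↔ Σ Y (λ y → T (q y))
↔-byCommonParametrisation {p = p} {q} F G = mk↔ₛ′ to from to∘from from∘to
  where
  module F = Parametrisation F
  module G = Parametrisation G

  to : Σ _ (T ∘ p) → Σ _ (T ∘ q)
  to (x , px) = G.encode (F.decode x) , proj₁ (G.encode-sound (proj₁ (F.decode-sound px)))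

  from : Σ _ (T ∘ q) → Σ _ (T ∘ p)
  from (y , qy) = F.encode (G.decode y) , proj₁ (F.encode-sound (proj₁ (G.decode-sound qy)))

  to∘from : ∀ y → to (from y) ≡ y
  to∘from (y , qy) = Σ-T-≡ (begin
    G.encode (F.decode (F.encode (G.decode y)))
      ≡⟨ cong G.encode (proj₂ (F.encode-sound (proj₁ (G.decode-sound qy)))) ⟩
    G.encode (G.decode y)
      ≡⟨ proj₂ (G.decode-sound qy) ⟩
    y ∎)

  from∘to : ∀ x → from (to x) ≡ x
  from∘to (x , px) = Σ-T-≡ (begin
    F.encode (G.decode (G.encode (F.decode x)))
      ≡⟨ cong F.encode (proj₂ (G.encode-sound (proj₁ (F.decode-sound px)))) ⟩
    F.encode (F.decode x)
      ≡⟨ proj₂ (F.decode-sound px) ⟩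
    x ∎)

module _ {A : Set} {R : A → A → Set} where

  AllPairs-++⁻ : ∀ xs {ys} → AllPairs R (xs ++ ys) →
                 AllPairs R xs × AllPairs R ys × All (λ x → All (R x) ys) xs
  AllPairs-++⁻ []       rys          = [] , rys , []
  AllPairs-++⁻ (x ∷ xs) (rx ∷ rxsys) =
    let rxs , rys , cross = AllPairs-++⁻ xs rxsys
    in All.++⁻ˡ xs rx ∷ rxs , rys , All.++⁻ʳ xs rx ∷ cross

  AllPairs-replicate⁺ : ∀ n {x} → R x x → AllPairs R (replicate n x)
  AllPairs-replicate⁺ zero    _   = []
  AllPairs-replicate⁺ (suc n) rxx = All.replicate⁺ n rxx ∷ AllPairs-replicate⁺ n rxx

module _ {A : Set} {P : A → Set} (P? : Decidable P) where

  takeWhile-++ : ∀ {xs ys} → All P xs → All (¬_ ∘ P) ys → takeWhile P? (xs ++ ys) ≡ xs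
  takeWhile-++ {x ∷ xs} (px ∷ pxs) ¬pys with P? x
  ... | yes _   = cong (x ∷_) (takeWhile-++ pxs ¬pys)
  ... | no  ¬px = ⊥-elim (¬px px)
  takeWhile-++ {[]} {[]}     [] []        = refl
  takeWhile-++ {[]} {y ∷ ys} [] (¬py ∷ _) with P? y
  ... | yes py = ⊥-elim (¬py py)
  ... | no  _  = refl

  dropWhile-++ : ∀ {xs ys} → All P xs → All (¬_ ∘ P) ys → dropWhile P? (xs ++ ys) ≡ ys
  dropWhile-++ {x ∷ xs} (px ∷ pxs) ¬pys with P? x
  ... | yes _   = dropWhile-++ pxs ¬pys
  ... | no  ¬px = ⊥-elim (¬px px)
  dropWhile-++ {[]} {[]}     [] []        = refl
  dropWhile-++ {[]} {y ∷ ys} [] (¬py ∷ _) with P? y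
  ... | yes py = ⊥-elim (¬py py)
  ... | no  _  = refl

  module _ {R : A → A → Set} where

    AllPairs-takeWhile⁺ : ∀ {xs} → AllPairs R xs → AllPairs R (takeWhile P? xs)
    AllPairs-takeWhile⁺ {[]}     []         = []
    AllPairs-takeWhile⁺ {x ∷ xs} (rx ∷ rxs) with P? x
    ... | yes _ = takeWhile⁺ P? rx ∷ AllPairs-takeWhile⁺ rxs
    ... | no  _ = []

    AllPairs-dropWhile⁺ : ∀ {xs} → AllPairs R xs → AllPairs R (dropWhile P? xs)
    AllPairs-dropWhile⁺ {[]}     []         = []
    AllPairs-dropWhile⁺ {x ∷ xs} (rx ∷ rxs) with P? x
    ... | yes _ = AllPairs-dropWhile⁺ rxs
    ... | no  _ = rx ∷ rxs

    dropWhile-upClosed : (∀ {x y} → R x y → ¬ P x → ¬ P y) →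
                         ∀ {xs} → AllPairs R xs → All (¬_ ∘ P) (dropWhile P? xs)
    dropWhile-upClosed closed {[]}     []         = []
    dropWhile-upClosed closed {x ∷ xs} (rx ∷ rxs) with P? x
    ... | yes _  = dropWhile-upClosed closed rxs
    ... | no ¬px = ¬px ∷ All.map (λ rxy → closed rxy ¬px) rx

sum-map-suc : ∀ xs → sum (map suc xs) ≡ length xs + sum xs
sum-map-suc []       = refl
sum-map-suc (x ∷ xs) = cong suc (trans (cong (x +_) (sum-map-suc xs)) (x∙yz≈y∙xz x (length xs) (sum xs)))

map-suc-pred : ∀ {xs} → All (1 ≤_) xs → map suc (map pred xs) ≡ xs
map-suc-pred {[]}         []      = refl
map-suc-pred {suc x ∷ xs} (_ ∷ ps) = cong (suc x ∷_) (map-suc-pred ps)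

map-pred-suc : ∀ xs → map pred (map suc xs) ≡ xs
map-pred-suc xs = trans (sym (map-∘ xs)) (map-id xs)

sum-replicate-1 : ∀ n → sum (replicate n 1) ≡ n
sum-replicate-1 zero    = refl
sum-replicate-1 (suc n) = cong suc (sum-replicate-1 n)

≡-replicate : ∀ {A : Set} {x : A} {xs} → All (_≡ x) xs → xs ≡ replicate (length xs) x
≡-replicate []          = refl
≡-replicate {x = x} (refl ∷ xs) = cong (x ∷_) (≡-replicate xs)

drop-1-∷ : ∀ {A : Set} {x : A} {xs} → All (_≡ x) xs → x ∈ xs → x ∷ drop 1 xs ≡ xs
drop-1-∷ (refl ∷ _) _ = refl

splitAtIndex : ∀ {A : Set} (xs : List A) (i : Fin (length xs)) →
               ∃₂ λ ys zs → xs ≡ ys ++ lookup xs i ∷ zs ×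
                            length ys ≡ toℕ i × length zs ≡ length xs ∸ suc (toℕ i)
splitAtIndex (x ∷ xs) fzero    = [] , xs , refl , refl , refl
splitAtIndex (x ∷ xs) (fsuc i) =
  let ys , zs , xs≡ , |ys| , |zs| = splitAtIndex xs i
  in x ∷ ys , zs , cong (x ∷_) xs≡ , cong suc |ys| , |zs|

indexOfMiddle : ∀ {A : Set} ys (y : A) zs →
                Σ (Fin (length (ys ++ y ∷ zs))) λ i → toℕ i ≡ length ys × lookup (ys ++ y ∷ zs) i ≡ y
indexOfMiddle []       y zs = fzero , refl , refl
indexOfMiddle (x ∷ ys) y zs = let i , i≡ , lookup≡ = indexOfMiddle ys y zs in fsuc i , cong suc i≡ , lookup≡

length-middle : ∀ {A : Set} ys (y : A) zs → length (ys ++ y ∷ zs) ∸ suc (length ys) ≡ length zs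
length-middle ys y zs = trans (cong (_∸ suc (length ys)) (trans (length-++ ys) (+-suc (length ys) (length zs))))
                              (m+n∸m≡n (length ys) (length zs))

take-length-++ : ∀ {A : Set} (xs : List A) {ys} → take (length xs) (xs ++ ys) ≡ xs
take-length-++ []       = refl
take-length-++ (x ∷ xs) = cong (x ∷_) (take-length-++ xs)

drop-length-++ : ∀ {A : Set} (xs : List A) {y ys} → drop (suc (length xs)) (xs ++ y ∷ ys) ≡ ys
drop-length-++ []       = refl
drop-length-++ (x ∷ xs) = drop-length-++ xs

Nonincreasing : List ℕ → Set
Nonincreasing = AllPairs _≥_

Nonincreasing-++ : ∀ k {xs ys} → Nonincreasing xs → Nonincreasing ys →
                   All (k ≤_) xs → All (_≤ k) ys → Nonincreasing (xs ++ ys)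
Nonincreasing-++ k xs↓ ys↓ k≤xs ys≤k =
  AllPairs.++⁺ xs↓ ys↓ (All.map (λ k≤x → All.map (λ y≤k → ≤-trans y≤k k≤x) ys≤k) k≤xs)

-- On a nonincreasing list these are the parts > k and the parts ≤ k.
above atMost : ℕ → List ℕ → List ℕ
above  k = takeWhile (k <?_)
atMost k = dropWhile (k <?_)

above++atMost : ∀ k xs → above k xs ++ atMost k xs ≡ xs
above++atMost k = takeWhile++dropWhile (k <?_)

length-above+atMost : ∀ k xs → length (above k xs) + length (atMost k xs) ≡ length xs
length-above+atMost k xs = trans (sym (length-++ (above k xs))) (cong length (above++atMost k xs))

sum-above+atMost : ∀ k xs → sum (above k xs) + sum (atMost k xs) ≡ sum xs
sum-above+atMost k xs = trans (sym (sum-++ (above k xs) _)) (cong sum (above++atMost k xs))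

all-above : ∀ k xs → All (k <_) (above k xs)
all-above k = all-takeWhile (k <?_)

all-atMost : ∀ k {xs} → Nonincreasing xs → All (_≤ k) (atMost k xs)
all-atMost k xs↓ = All.map ≮⇒≥ (dropWhile-upClosed (k <?_) (λ y≤x k≮x k<y → k≮x (<-≤-trans k<y y≤x)) xs↓)

atMost-excluded : ∀ k {xs} → Nonincreasing xs → k ∉ xs → All (_< k) (atMost k xs)
atMost-excluded k xs↓ k∉xs =
  All.zipWith (λ (x≤k , k≢x) → ≤∧≢⇒< x≤k (k≢x ∘ sym)) (all-atMost k xs↓ , dropWhile⁺ (k <?_) (¬Any⇒All¬ _ k∉xs))

above-++ : ∀ k {xs ys} → All (k <_) xs → All (_≤ k) ys → above k (xs ++ ys) ≡ xs
above-++ k k<xs ys≤k = takeWhile-++ (k <?_) k<xs (All.map ≤⇒≯ ys≤k)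

atMost-++ : ∀ k {xs ys} → All (k <_) xs → All (_≤ k) ys → atMost k (xs ++ ys) ≡ ys
atMost-++ k k<xs ys≤k = dropWhile-++ (k <?_) k<xs (All.map ≤⇒≯ ys≤k)

∈-atMost : ∀ k {x xs} → x ≤ k → x ∈ xs → x ∈ atMost k xs
∈-atMost k {x} {xs} x≤k x∈xs with ∈-++⁻ (above k xs) (subst (x ∈_) (sym (above++atMost k xs)) x∈xs)
... | inj₁ x∈above  = ⊥-elim (≤⇒≯ x≤k (All.lookup (all-above k xs) x∈above))
... | inj₂ x∈atMost = x∈atMost

∈-above : ∀ k {x xs} → k < x → Nonincreasing xs → x ∈ xs → x ∈ above k xs
∈-above k {x} {xs} k<x xs↓ x∈xs with ∈-++⁻ (above k xs) (subst (x ∈_) (sym (above++atMost k xs)) x∈xs)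
... | inj₁ x∈above  = x∈above
... | inj₂ x∈atMost = ⊥-elim (≤⇒≯ (All.lookup (all-atMost k xs↓) x∈atMost) k<x)

-- Staircases

[1+n]C2≡n+nC2 : ∀ n → suc n C 2 ≡ n + n C 2
[1+n]C2≡n+nC2 n = trans (sym (nCk+nC[k+1]≡[n+1]C[k+1] n 1)) (cong (_+ n C 2) (nC1≡n n))

-- Merges one part of each size 1, …, j into a nonincreasing list with parts ≤ j;
-- removeStaircase drops one copy of each size again.
addStaircase : ℕ → List ℕ → List ℕ
addStaircase zero    xs = xs
addStaircase (suc j) xs = suc j ∷ above j xs ++ addStaircase j (atMost j xs)

removeStaircase : ℕ → List ℕ → List ℕ
removeStaircase zero    xs = xs
removeStaircase (suc j) xs = drop 1 (above j xs) ++ removeStaircase j (atMost j xs)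

length-addStaircase : ∀ j xs → length (addStaircase j xs) ≡ j + length xs
length-addStaircase zero    xs = refl
length-addStaircase (suc j) xs = cong suc (begin
  length (above j xs ++ addStaircase j (atMost j xs))
    ≡⟨ length-++ (above j xs) ⟩
  length (above j xs) + length (addStaircase j (atMost j xs))
    ≡⟨ cong (length (above j xs) +_) (length-addStaircase j (atMost j xs)) ⟩
  length (above j xs) + (j + length (atMost j xs))
    ≡⟨ x∙yz≈y∙xz (length (above j xs)) j (length (atMost j xs)) ⟩
  j + (length (above j xs) + length (atMost j xs))
    ≡⟨ cong (j +_) (length-above+atMost j xs) ⟩
  j + length xs ∎)

sum-addStaircase : ∀ j xs → sum (addStaircase j xs) ≡ suc j C 2 + sum xs
sum-addStaircase zero    xs = refl
sum-addStaircase (suc j) xs = begin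
  suc j + sum (above j xs ++ addStaircase j (atMost j xs))
    ≡⟨ cong (suc j +_) (sum-++ (above j xs) _) ⟩
  suc j + (sum (above j xs) + sum (addStaircase j (atMost j xs)))
    ≡⟨ cong (λ s → suc j + (sum (above j xs) + s)) (sum-addStaircase j (atMost j xs)) ⟩
  suc j + (sum (above j xs) + (suc j C 2 + sum (atMost j xs)))
    ≡⟨ cong (suc j +_) (x∙yz≈y∙xz (sum (above j xs)) (suc j C 2) (sum (atMost j xs))) ⟩
  suc j + (suc j C 2 + (sum (above j xs) + sum (atMost j xs)))
    ≡⟨ cong (λ s → suc j + (suc j C 2 + s)) (sum-above+atMost j xs) ⟩
  suc j + (suc j C 2 + sum xs)
    ≡⟨ sym (+-assoc (suc j) (suc j C 2) (sum xs)) ⟩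
  suc j + suc j C 2 + sum xs
    ≡⟨ cong (_+ sum xs) (sym ([1+n]C2≡n+nC2 (suc j))) ⟩
  suc (suc j) C 2 + sum xs ∎

All-addStaircase : ∀ {P : ℕ → Set} j {xs} → All P xs → (∀ {i} → i < j → P (suc i)) →
                   All P (addStaircase j xs)
All-addStaircase zero    pxs _        = pxs
All-addStaircase (suc j) pxs P[1+i] =
  P[1+i] ≤-refl ∷ All.++⁺ (takeWhile⁺ (j <?_) pxs)
                           (All-addStaircase j (dropWhile⁺ (j <?_) pxs) (P[1+i] ∘ m<n⇒m<1+n))

All-removeStaircase : ∀ {P : ℕ → Set} j {xs} → All P xs → All P (removeStaircase j xs)
All-removeStaircase zero    pxs = pxs
All-removeStaircase (suc j) pxs =
  All.++⁺ (All.drop⁺ 1 (takeWhile⁺ (j <?_) pxs)) (All-removeStaircase j (dropWhile⁺ (j <?_) pxs))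

∈-addStaircase : ∀ j {xs i} → i < j → suc i ∈ addStaircase j xs
∈-addStaircase (suc j) {xs} {i} i<1+j with i ≟ j
... | yes refl = here refl
... | no  i≢j  = there (∈-++⁺ʳ (above j xs) (∈-addStaircase j (≤∧≢⇒< (≤-pred i<1+j) i≢j)))

addStaircase-sorted : ∀ j {xs} → Nonincreasing xs → All (_≤ j) xs → Nonincreasing (addStaircase j xs)
addStaircase-sorted zero    xs↓ _   = xs↓
addStaircase-sorted (suc j) {xs} xs↓ xs≤ =
  All.++⁺ (takeWhile⁺ (j <?_) xs≤) (All.map m≤n⇒m≤1+n rest≤j)
  ∷ Nonincreasing-++ j (AllPairs-takeWhile⁺ (j <?_) xs↓)
                       (addStaircase-sorted j (AllPairs-dropWhile⁺ (j <?_) xs↓) (all-atMost j xs↓))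
                       (All.map <⇒≤ (all-above j xs)) rest≤j
  where
  rest≤j : All (_≤ j) (addStaircase j (atMost j xs))
  rest≤j = All-addStaircase j (all-atMost j xs↓) (λ i<j → i<j)

removeStaircase-sorted : ∀ j {xs} → Nonincreasing xs → Nonincreasing (removeStaircase j xs)
removeStaircase-sorted zero    xs↓ = xs↓
removeStaircase-sorted (suc j) {xs} xs↓ =
  Nonincreasing-++ j (AllPairs.drop⁺ 1 (AllPairs-takeWhile⁺ (j <?_) xs↓))
                     (removeStaircase-sorted j (AllPairs-dropWhile⁺ (j <?_) xs↓))
                     (All.drop⁺ 1 (All.map <⇒≤ (all-above j xs)))
                     (All-removeStaircase j (all-atMost j xs↓))

removeStaircase-addStaircase : ∀ j {xs} → Nonincreasing xs → removeStaircase j (addStaircase j xs) ≡ xs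
removeStaircase-addStaircase zero    _   = refl
removeStaircase-addStaircase (suc j) {xs} xs↓ = begin
  drop 1 (above j (top ++ lower)) ++ removeStaircase j (atMost j (top ++ lower))
    ≡⟨ cong₂ (λ as bs → drop 1 as ++ removeStaircase j bs)
             (above-++ j top>j lower≤j) (atMost-++ j top>j lower≤j) ⟩
  above j xs ++ removeStaircase j (addStaircase j (atMost j xs))
    ≡⟨ cong (above j xs ++_) (removeStaircase-addStaircase j (AllPairs-dropWhile⁺ (j <?_) xs↓)) ⟩
  above j xs ++ atMost j xs
    ≡⟨ above++atMost j xs ⟩
  xs ∎
  where
  top = suc j ∷ above j xs
  lower = addStaircase j (atMost j xs)
  top>j : All (j <_) top
  top>j = ≤-refl ∷ all-above j xs
  lower≤j : All (_≤ j) lower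
  lower≤j = All-addStaircase j (all-atMost j xs↓) (λ i<j → i<j)

addStaircase-removeStaircase : ∀ j {xs} → Nonincreasing xs → All (_≤ j) xs →
                               (∀ {i} → i < j → suc i ∈ xs) →
                               addStaircase j (removeStaircase j xs) ≡ xs
addStaircase-removeStaircase zero    _   _   _      = refl
addStaircase-removeStaircase (suc j) {xs} xs↓ xs≤ covers = begin
  suc j ∷ above j (extra ++ lower) ++ addStaircase j (atMost j (extra ++ lower))
    ≡⟨ cong₂ (λ as bs → suc j ∷ as ++ addStaircase j bs)
             (above-++ j extra>j lower≤j) (atMost-++ j extra>j lower≤j) ⟩
  (suc j ∷ extra) ++ addStaircase j (removeStaircase j (atMost j xs))
    ≡⟨ cong₂ _++_ (drop-1-∷ above≡1+j (∈-above j ≤-refl xs↓ (covers ≤-refl)))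
                  (addStaircase-removeStaircase j (AllPairs-dropWhile⁺ (j <?_) xs↓) (all-atMost j xs↓)
                     (λ i<j → ∈-atMost j i<j (covers (m<n⇒m<1+n i<j)))) ⟩
  above j xs ++ atMost j xs
    ≡⟨ above++atMost j xs ⟩
  xs ∎
  where
  extra = drop 1 (above j xs)
  lower = removeStaircase j (atMost j xs)
  extra>j : All (j <_) extra
  extra>j = All.drop⁺ 1 (all-above j xs)
  lower≤j : All (_≤ j) lower
  lower≤j = All-removeStaircase j (all-atMost j xs↓)
  above≡1+j : All (_≡ suc j) (above j xs)
  above≡1+j = All.zipWith (λ (j<x , x≤1+j) → ≤-antisym x≤1+j j<x) (all-above j xs , takeWhile⁺ (j <?_) xs≤)

-- First columns

addFirstColumn : ℕ → List ℕ → List ℕ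
addFirstColumn c xs = map suc xs ++ replicate c 1

removeFirstColumn : List ℕ → List ℕ
removeFirstColumn xs = map pred (above 1 xs)

length-addFirstColumn : ∀ c xs → length (addFirstColumn c xs) ≡ length xs + c
length-addFirstColumn c xs =
  trans (length-++ (map suc xs)) (cong₂ _+_ (length-map suc xs) (length-replicate c))

sum-addFirstColumn : ∀ c xs → sum (addFirstColumn c xs) ≡ length xs + sum xs + c
sum-addFirstColumn c xs = trans (sum-++ (map suc xs) _) (cong₂ _+_ (sum-map-suc xs) (sum-replicate-1 c))

addFirstColumn-sorted : ∀ c {xs} → Nonincreasing xs → Nonincreasing (addFirstColumn c xs)
addFirstColumn-sorted c {xs} xs↓ =
  Nonincreasing-++ 1 (AllPairs.map⁺ (AllPairs.map s≤s xs↓)) (AllPairs-replicate⁺ c ≤-refl)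
                     (All.map⁺ (All.universal (λ _ → s≤s z≤n) xs)) (All.replicate⁺ c ≤-refl)

addFirstColumn-positive : ∀ c xs → All (1 ≤_) (addFirstColumn c xs)
addFirstColumn-positive c xs = All.++⁺ (All.map⁺ (All.universal (λ _ → s≤s z≤n) xs)) (All.replicate⁺ c ≤-refl)

addFirstColumn-≤ : ∀ c {j xs} → All (_≤ j) xs → All (_≤ suc j) (addFirstColumn c xs)
addFirstColumn-≤ c xs≤j = All.++⁺ (All.map⁺ (All.map s≤s xs≤j)) (All.replicate⁺ c (s≤s z≤n))

removeFirstColumn-sorted : ∀ {xs} → Nonincreasing xs → Nonincreasing (removeFirstColumn xs)
removeFirstColumn-sorted xs↓ = AllPairs.map⁺ (AllPairs.map pred-mono-≤ (AllPairs-takeWhile⁺ (1 <?_) xs↓))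

removeFirstColumn-positive : ∀ xs → All (1 ≤_) (removeFirstColumn xs)
removeFirstColumn-positive xs = All.map⁺ (All.map pred-mono-≤ (all-above 1 xs))

removeFirstColumn-≤ : ∀ {j xs} → All (_≤ suc j) xs → All (_≤ j) (removeFirstColumn xs)
removeFirstColumn-≤ xs≤ = All.map⁺ (All.map pred-mono-≤ (takeWhile⁺ (1 <?_) xs≤))

length-removeFirstColumn : ∀ xs → length (removeFirstColumn xs) ≤ length xs
length-removeFirstColumn xs =
  subst₂ _≤_ (sym (length-map pred (above 1 xs))) (length-above+atMost 1 xs) (m≤m+n _ _)

removeFirstColumn-addFirstColumn : ∀ c {xs} → All (1 ≤_) xs → removeFirstColumn (addFirstColumn c xs) ≡ xs
removeFirstColumn-addFirstColumn c {xs} xs≥1 =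
  trans (cong (map pred) (above-++ 1 (All.map⁺ (All.map s≤s xs≥1)) (All.replicate⁺ c ≤-refl)))
        (map-pred-suc xs)

addFirstColumn-removeFirstColumn : ∀ {xs} → Nonincreasing xs → All (1 ≤_) xs →
  addFirstColumn (length xs ∸ length (removeFirstColumn xs)) (removeFirstColumn xs) ≡ xs
addFirstColumn-removeFirstColumn {xs} xs↓ xs≥1 = begin
  map suc (map pred (above 1 xs)) ++ replicate (length xs ∸ length (map pred (above 1 xs))) 1
    ≡⟨ cong₂ _++_ (map-suc-pred (All.map <⇒≤ (all-above 1 xs))) (cong (λ c → replicate c 1) #ones) ⟩
  above 1 xs ++ replicate (length (atMost 1 xs)) 1
    ≡⟨ cong (above 1 xs ++_) (sym (≡-replicate ones)) ⟩
  above 1 xs ++ atMost 1 xs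
    ≡⟨ above++atMost 1 xs ⟩
  xs ∎
  where
  ones : All (_≡ 1) (atMost 1 xs)
  ones = All.zipWith (λ (x≤1 , 1≤x) → ≤-antisym x≤1 1≤x) (all-atMost 1 xs↓ , dropWhile⁺ (1 <?_) xs≥1)
  #ones : length xs ∸ length (map pred (above 1 xs)) ≡ length (atMost 1 xs)
  #ones = begin
    length xs ∸ length (map pred (above 1 xs))
      ≡⟨ cong₂ _∸_ (sym (length-above+atMost 1 xs)) (length-map pred (above 1 xs)) ⟩
    length (above 1 xs) + length (atMost 1 xs) ∸ length (above 1 xs)
      ≡⟨ m+n∸m≡n (length (above 1 xs)) _ ⟩
    length (atMost 1 xs) ∎

nonincreasing⇒Linked : ∀ xs → T (nonincreasing xs) → Linked _≥_ xs
nonincreasing⇒Linked []           _ = []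
nonincreasing⇒Linked (x ∷ [])     _ = [-]
nonincreasing⇒Linked (x ∷ y ∷ xs) t =
  let y≤x , rest = Equivalence.to (T-∧ {y ≤ᵇ x}) t
  in ≤ᵇ⇒≤ y x y≤x ∷ nonincreasing⇒Linked (y ∷ xs) rest

Linked⇒nonincreasing : ∀ {xs} → Linked _≥_ xs → T (nonincreasing xs)
Linked⇒nonincreasing []           = _
Linked⇒nonincreasing [-]          = _
Linked⇒nonincreasing (y≤x ∷ rest) = Equivalence.from T-∧ (≤⇒≤ᵇ y≤x , Linked⇒nonincreasing rest)

nonincreasing⇔ : ∀ xs → T (nonincreasing xs) ⇔ Nonincreasing xs
nonincreasing⇔ xs = mk⇔ (Linked⇒AllPairs (flip ≤-trans) ∘ nonincreasing⇒Linked xs)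
                        (Linked⇒nonincreasing ∘ AllPairs⇒Linked)

positive⇔ : ∀ xs → T (all (1 ≤ᵇ_) xs) ⇔ All (1 ≤_) xs
positive⇔ xs = mk⇔ (All.map (≤ᵇ⇒≤ 1 _) ∘ all⁺ _ xs) (all⁻ _ ∘ All.map ≤⇒≤ᵇ)

isPartition⇔ : ∀ xs → T (isPartition xs) ⇔ (Nonincreasing xs × All (1 ≤_) xs)
isPartition⇔ xs = (nonincreasing⇔ xs ×-⇔ positive⇔ xs) ⇔-∘ T-∧

≡ᵇ⇔ : ∀ {m n} → T (m ≡ᵇ n) ⇔ m ≡ n
≡ᵇ⇔ {m} {n} = mk⇔ (≡ᵇ⇒≡ m n) (≡⇒≡ᵇ m n)

<ᵇ⇔ : ∀ {m n} → T (m <ᵇ n) ⇔ m < n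
<ᵇ⇔ {m} {n} = mk⇔ (<ᵇ⇒< m n) <⇒<ᵇ

occurs⇔ : ∀ v xs → T (occurs v xs) ⇔ v ∈ xs
occurs⇔ v xs = mk⇔ (Any.map (λ {x} t → sym (≡ᵇ⇒≡ x v t)) ∘ any⁻ _ xs)
                   (any⁺ _ ∘ Any.map (λ {x} v≡x → ≡⇒≡ᵇ x v (sym v≡x)))

T-not⇔¬T : ∀ b → T (not b) ⇔ (¬ T b)
T-not⇔¬T true  = mk⇔ (λ ()) (λ ¬t → ¬t _)
T-not⇔¬T false = mk⇔ (λ _ ()) (λ _ → _)

mexIs⇔ : ∀ j μ → T (mexIs μ (suc j)) ⇔ (suc j ∉ μ × (∀ {i} → i < j → suc i ∈ μ))
mexIs⇔ j μ = (excludes⇔ ×-⇔ covers⇔) ⇔-∘ T-∧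
  where
  excludes⇔ : T (not (occurs (suc j) μ)) ⇔ (suc j ∉ μ)
  excludes⇔ = mk⇔ (λ t → Equivalence.to (T-not⇔¬T _) t ∘ Equivalence.from (occurs⇔ (suc j) μ))
                  (λ ∉μ → Equivalence.from (T-not⇔¬T _) (∉μ ∘ Equivalence.to (occurs⇔ (suc j) μ)))
  covers⇔ : T (all (λ i → occurs (suc i) μ) (upTo j)) ⇔ (∀ {i} → i < j → suc i ∈ μ)
  covers⇔ = mk⇔ (λ t {i} → applyUpTo⁻ _ j (All.map (Equivalence.to (occurs⇔ _ μ)) (all⁺ _ _ t)))
                (λ covers → all⁻ _ (applyUpTo⁺₁ _ j
                   (λ {i} i<j → Equivalence.from (occurs⇔ (suc i) μ) (covers i<j))))

fixedHook⇔ : ∀ k xs → T (hasMinusOneFixedHookOfSize k xs) ⇔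
             (∃₂ λ ys zs → xs ≡ ys ++ k ∷ zs × length ys ≡ k + length zs)
fixedHook⇔ k xs = mk⇔ to from
  where
  to : T (hasMinusOneFixedHookOfSize k xs) → ∃₂ λ ys zs → xs ≡ ys ++ k ∷ zs × length ys ≡ k + length zs
  to t =
    let i , fixed = Any.satisfied (any⁻ _ (allFin (length xs)) t)
        hook≡i , part≡k = Equivalence.to ((≡ᵇ⇔ ×-⇔ ≡ᵇ⇔) ⇔-∘ T-∧) fixed
        ys , zs , xs≡ , |ys| , |zs| = splitAtIndex xs i
    in ys , zs , trans xs≡ (cong (λ y → ys ++ y ∷ zs) part≡k) , (begin
         length ys                                  ≡⟨ |ys| ⟩
         toℕ i                                      ≡⟨ hook≡i ⟨
         lookup xs i + (length xs ∸ suc (toℕ i))    ≡⟨ cong₂ _+_ part≡k (sym |zs|) ⟩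
         k + length zs                              ∎)

  from : (∃₂ λ ys zs → xs ≡ ys ++ k ∷ zs × length ys ≡ k + length zs) → T (hasMinusOneFixedHookOfSize k xs)
  from (ys , zs , refl , |ys|≡) =
    let i , i≡ , lookup≡ = indexOfMiddle ys k zs
        hook≡i = begin
          lookup xs i + (length xs ∸ suc (toℕ i))       ≡⟨ cong₂ (λ y m → y + (length xs ∸ suc m)) lookup≡ i≡ ⟩
          k + (length xs ∸ suc (length ys))             ≡⟨ cong (k +_) (length-middle ys k zs) ⟩
          k + length zs                                 ≡⟨ |ys|≡ ⟨
          length ys                                     ≡⟨ i≡ ⟨
          toℕ i                                         ∎
    in any⁺ _ (Any.map (λ { refl → Equivalence.from ((≡ᵇ⇔ ×-⇔ ≡ᵇ⇔) ⇔-∘ T-∧) (hook≡i , lookup≡) }) (∈-allFin i))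

record Core (j n : ℕ) (A D : List ℕ) : Set where
  field
    A-sorted   : Nonincreasing A
    A-large    : All (suc j ≤_) A
    D-sorted   : Nonincreasing D
    D-positive : All (1 ≤_) D
    D-small    : All (_≤ j) D
    D-short    : length D + suc j ≤ length A
    weight     : length A + sum A + (suc j C 2 + sum D) ≡ n

-- Partitions with mex k

mexCondition : ℕ → ℕ → List ℕ → Bool
mexCondition k n μ = isPartitionOf n μ ∧ (mexIs μ k ∧ (#partsSmaller k μ <ᵇ #partsLarger k μ))

MexPartition : ℕ → ℕ → List ℕ → Set
MexPartition j n μ =
  ((Nonincreasing μ × All (1 ≤_) μ) × sum μ ≡ n) ×
  (suc j ∉ μ × (∀ {i} → i < j → suc i ∈ μ)) × #partsSmaller (suc j) μ < #partsLarger (suc j) μ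

mexCondition⇔ : ∀ j n μ → T (mexCondition (suc j) n μ) ⇔ MexPartition j n μ
mexCondition⇔ j n μ =
  (((isPartition⇔ μ ×-⇔ ≡ᵇ⇔) ⇔-∘ T-∧) ×-⇔ ((mexIs⇔ j μ ×-⇔ <ᵇ⇔) ⇔-∘ T-∧)) ⇔-∘ T-∧

#parts-++ : ∀ k {xs ys} → All (k <_) xs → All (_< k) ys →
            #partsSmaller k (xs ++ ys) ≡ length ys × #partsLarger k (xs ++ ys) ≡ length xs
#parts-++ k {xs} {ys} k<xs ys<k =
  (begin
    length (filterᵇ (_<ᵇ k) (xs ++ ys))
      ≡⟨ cong length (filter-++ (T? ∘ (_<ᵇ k)) xs ys) ⟩
    length (filterᵇ (_<ᵇ k) xs ++ filterᵇ (_<ᵇ k) ys)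
      ≡⟨ cong₂ (λ as bs → length (as ++ bs))
               (filter-none (T? ∘ (_<ᵇ k)) (All.map (λ k<x → <⇒≯ k<x ∘ <ᵇ⇒< _ k) k<xs))
               (filter-all (T? ∘ (_<ᵇ k)) (All.map <⇒<ᵇ ys<k)) ⟩
    length ys ∎) ,
  (begin
    length (filterᵇ (k <ᵇ_) (xs ++ ys))
      ≡⟨ cong length (filter-++ (T? ∘ (k <ᵇ_)) xs ys) ⟩
    length (filterᵇ (k <ᵇ_) xs ++ filterᵇ (k <ᵇ_) ys)
      ≡⟨ cong₂ (λ as bs → length (as ++ bs))
               (filter-all (T? ∘ (k <ᵇ_)) (All.map <⇒<ᵇ k<xs))
               (filter-none (T? ∘ (k <ᵇ_)) (All.map (λ y<k → <⇒≯ y<k ∘ <ᵇ⇒< k _) ys<k)) ⟩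
    length (xs ++ [])
      ≡⟨ cong length (++-identityʳ xs) ⟩
    length xs ∎)

mexEncode : ℕ → List ℕ × List ℕ → List ℕ
mexEncode j (A , D) = map suc A ++ addStaircase j D

mexDecode : ℕ → List ℕ → List ℕ × List ℕ
mexDecode j μ = map pred (above (suc j) μ) , removeStaircase j (atMost (suc j) μ)

mexDecode-sound : ∀ j n {μ} → MexPartition j n μ →
                  uncurry (Core j n) (mexDecode j μ) × mexEncode j (mexDecode j μ) ≡ μ
mexDecode-sound j n {μ} (((μ↓ , μ≥1) , Σμ≡n) , (k∉μ , covers) , fewer) = core , encode∘decode
  where
  k = suc j
  P = above k μ
  R = atMost k μ
  D = removeStaircase j R
  R↓ : Nonincreasing R
  R↓ = AllPairs-dropWhile⁺ (k <?_) μ↓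
  R<k : All (_< k) R
  R<k = atMost-excluded k μ↓ k∉μ
  R≤j : All (_≤ j) R
  R≤j = All.map ≤-pred R<k
  R≡ : addStaircase j D ≡ R
  R≡ = addStaircase-removeStaircase j R↓ R≤j (λ i<j → ∈-atMost k (m≤n⇒m≤1+n i<j) (covers i<j))
  |R|≡ : length R ≡ j + length D
  |R|≡ = trans (cong length (sym R≡)) (length-addStaircase j D)
  P≥1 : All (1 ≤_) P
  P≥1 = All.map (λ k<x → ≤-trans (s≤s z≤n) (<⇒≤ k<x)) (all-above k μ)
  |R|<|P| : length R < length P
  |R|<|P| = let smaller , larger = #parts-++ k (all-above k μ) R<k
            in subst₂ _<_ smaller larger
                      (subst (λ ν → #partsSmaller k ν < #partsLarger k ν) (sym (above++atMost k μ)) fewer)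
  core : uncurry (Core j n) (mexDecode j μ)
  core = record
    { A-sorted   = AllPairs.map⁺ (AllPairs.map pred-mono-≤ (AllPairs-takeWhile⁺ (k <?_) μ↓))
    ; A-large    = All.map⁺ (All.map pred-mono-≤ (all-above k μ))
    ; D-sorted   = removeStaircase-sorted j R↓
    ; D-positive = All-removeStaircase j (dropWhile⁺ (k <?_) μ≥1)
    ; D-small    = All-removeStaircase j R≤j
    ; D-short    = subst₂ _≤_ (trans (cong suc |R|≡) (+-comm k (length D))) (sym (length-map pred P)) |R|<|P|
    ; weight     = begin
        length (map pred P) + sum (map pred P) + (k C 2 + sum D)
          ≡⟨ cong₂ _+_ (trans (sym (sum-map-suc (map pred P))) (cong sum (map-suc-pred P≥1)))
                       (trans (sym (sum-addStaircase j D)) (cong sum R≡)) ⟩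
        sum P + sum R   ≡⟨ sum-above+atMost k μ ⟩
        sum μ           ≡⟨ Σμ≡n ⟩
        n               ∎
    }
  encode∘decode : map suc (map pred P) ++ addStaircase j D ≡ μ
  encode∘decode = trans (cong₂ _++_ (map-suc-pred P≥1) R≡) (above++atMost k μ)

mexEncode-sound : ∀ j n {A D} → Core j n A D →
                  MexPartition j n (mexEncode j (A , D)) × mexDecode j (mexEncode j (A , D)) ≡ (A , D)
mexEncode-sound j n {A} {D} core = (((μ↓ , μ≥1) , Σμ≡n) , (k∉μ , covers) , fewer) , decode∘encode
  where
  open Core core
  k = suc j
  P = map suc A
  R = addStaircase j D
  P>k : All (k <_) P
  P>k = All.map⁺ (All.map s≤s A-large)
  R≤j : All (_≤ j) R
  R≤j = All-addStaircase j D-small (λ i<j → i<j)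
  R≤k : All (_≤ k) R
  R≤k = All.map m≤n⇒m≤1+n R≤j
  μ↓ : Nonincreasing (P ++ R)
  μ↓ = Nonincreasing-++ k (AllPairs.map⁺ (AllPairs.map s≤s A-sorted)) (addStaircase-sorted j D-sorted D-small)
                          (All.map <⇒≤ P>k) R≤k
  μ≥1 : All (1 ≤_) (P ++ R)
  μ≥1 = All.++⁺ (All.map⁺ (All.universal (λ _ → s≤s z≤n) A)) (All-addStaircase j D-positive (λ _ → s≤s z≤n))
  Σμ≡n : sum (P ++ R) ≡ n
  Σμ≡n = trans (sum-++ P R) (trans (cong₂ _+_ (sum-map-suc A) (sum-addStaircase j D)) weight)
  k∉μ : k ∉ P ++ R
  k∉μ k∈μ with ∈-++⁻ P k∈μ
  ... | inj₁ k∈P = <-irrefl refl (All.lookup P>k k∈P)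
  ... | inj₂ k∈R = 1+n≰n (All.lookup R≤j k∈R)
  covers : ∀ {i} → i < j → suc i ∈ P ++ R
  covers i<j = ∈-++⁺ʳ P (∈-addStaircase j i<j)
  fewer : #partsSmaller k (P ++ R) < #partsLarger k (P ++ R)
  fewer = let smaller , larger = #parts-++ k P>k (All.map s≤s R≤j)
          in subst₂ _<_ (sym (trans smaller (length-addStaircase j D)))
                        (sym (trans larger (length-map suc A)))
                        (subst (_≤ length A) (+-comm (length D) k) D-short)
  decode∘encode : mexDecode j (P ++ R) ≡ (A , D)
  decode∘encode = cong₂ _,_ (trans (cong (map pred) (above-++ k P>k R≤k)) (map-pred-suc A))
                            (trans (cong (removeStaircase j) (atMost-++ k P>k R≤k))
                                   (removeStaircase-addStaircase j D-sorted))

mexParametrisation : ∀ j n → Parametrisation (mexCondition (suc j) n) (uncurry (Core j n))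
mexParametrisation j n = record
  { encode       = mexEncode j
  ; decode       = mexDecode j
  ; decode-sound = mexDecode-sound j n ∘ Equivalence.to (mexCondition⇔ j n _)
  ; encode-sound = λ { {A , D} core → let mex , decode∘encode = mexEncode-sound j n core
                                     in Equivalence.from (mexCondition⇔ j n _) mex , decode∘encode }
  }

-- Partitions with a (−1)-fixed hook

hookCondition : ℕ → ℕ → List ℕ → Bool
hookCondition k n ν = isPartition ν ∧ ((sum ν + k C 2 ≡ᵇ n) ∧ hasMinusOneFixedHookOfSize k ν)

HookPartition : ℕ → ℕ → List ℕ → Set
HookPartition j n ν =
  (Nonincreasing ν × All (1 ≤_) ν) ×
  sum ν + suc j C 2 ≡ n × (∃₂ λ A B → ν ≡ A ++ suc j ∷ B × length A ≡ suc j + length B)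

hookCondition⇔ : ∀ j n ν → T (hookCondition (suc j) n ν) ⇔ HookPartition j n ν
hookCondition⇔ j n ν = (isPartition⇔ ν ×-⇔ ((≡ᵇ⇔ ×-⇔ fixedHook⇔ (suc j) ν) ⇔-∘ T-∧)) ⇔-∘ T-∧

hookEncode : ℕ → List ℕ × List ℕ → List ℕ
hookEncode j (A , D) = A ++ suc j ∷ addFirstColumn (length A ∸ suc j ∸ length D) D

-- A fixed hook in row r + 1 forces 2r = length ν + j, which locates it.
hookDecode : ℕ → List ℕ → List ℕ × List ℕ
hookDecode j ν = let r = ⌊ length ν + j /2⌋ in take r ν , removeFirstColumn (drop (suc r) ν)

fixedHookRow : ∀ j {A B} → length A ≡ suc j + length B → ⌊ length (A ++ suc j ∷ B) + j /2⌋ ≡ length A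
fixedHookRow j {A} {B} |A|≡ = begin
  ⌊ length (A ++ suc j ∷ B) + j /2⌋      ≡⟨ cong (λ m → ⌊ m + j /2⌋) (length-++ A) ⟩
  ⌊ length A + suc (length B) + j /2⌋    ≡⟨ cong ⌊_/2⌋ (+-assoc (length A) (suc (length B)) j) ⟩
  ⌊ length A + suc (length B + j) /2⌋    ≡⟨ cong (λ m → ⌊ length A + suc m /2⌋) (+-comm (length B) j) ⟩
  ⌊ length A + (suc j + length B) /2⌋    ≡⟨ cong (λ m → ⌊ length A + m /2⌋) |A|≡ ⟨
  ⌊ length A + length A /2⌋              ≡⟨ n≡⌊n+n/2⌋ (length A) ⟨
  length A                               ∎

hookDecode-++ : ∀ j {A B} → length A ≡ suc j + length B →
                hookDecode j (A ++ suc j ∷ B) ≡ (A , removeFirstColumn B)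
hookDecode-++ j {A} {B} |A|≡ =
  subst (λ r → (take r ν , removeFirstColumn (drop (suc r) ν)) ≡ (A , removeFirstColumn B))
        (sym (fixedHookRow j {A} {B} |A|≡))
        (cong₂ _,_ (take-length-++ A) (cong removeFirstColumn (drop-length-++ A)))
  where ν = A ++ suc j ∷ B

hook-weight : ∀ j c {A B D} → B ≡ addFirstColumn c D → length A ≡ suc j + length B →
              sum (A ++ suc j ∷ B) + suc j C 2 ≡ length A + sum A + (suc j C 2 + sum D)
hook-weight j c {A} {B} {D} B≡ |A|≡ = begin
  sum (A ++ suc j ∷ B) + suc j C 2
    ≡⟨ cong (_+ suc j C 2) (sum-++ A (suc j ∷ B)) ⟩
  sum A + (suc j + sum B) + suc j C 2
    ≡⟨ cong (λ s → sum A + (suc j + s) + suc j C 2) (trans (cong sum B≡) (sum-addFirstColumn c D)) ⟩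
  sum A + (suc j + (length D + sum D + c)) + suc j C 2
    ≡⟨ rearrange (sum A) (suc j) (length D) (sum D) c (suc j C 2) ⟩
  suc j + (length D + c) + sum A + (suc j C 2 + sum D)
    ≡⟨ cong (λ m → m + sum A + (suc j C 2 + sum D))
            (trans (cong (λ b → suc j + length b) B≡) (cong (suc j +_) (length-addFirstColumn c D))) ⟨
  suc j + length B + sum A + (suc j C 2 + sum D)
    ≡⟨ cong (λ m → m + sum A + (suc j C 2 + sum D)) |A|≡ ⟨
  length A + sum A + (suc j C 2 + sum D) ∎
  where
  rearrange : ∀ a k d s c t → a + (k + (d + s + c)) + t ≡ k + (d + c) + a + (t + s)
  rearrange = solve-∀

hookDecode-sound : ∀ j n {ν} → HookPartition j n ν →
                   uncurry (Core j n) (hookDecode j ν) × hookEncode j (hookDecode j ν) ≡ ν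
hookDecode-sound j n ((ν↓ , ν≥1) , Σν≡n , A , B , refl , |A|≡)
  with A↓ , (B≤k ∷ B↓) , A≥kB ← AllPairs-++⁻ A ν↓
  = subst (λ AD → uncurry (Core j n) AD × hookEncode j AD ≡ A ++ suc j ∷ B)
          (sym (hookDecode-++ j {A} {B} |A|≡))
          (core , cong (λ b → A ++ suc j ∷ b) (trans (cong (λ c → addFirstColumn c D) #ones) B≡))
  where
  D = removeFirstColumn B
  #ones : length A ∸ suc j ∸ length D ≡ length B ∸ length D
  #ones = cong (_∸ length D) (trans (cong (_∸ suc j) |A|≡) (m+n∸m≡n (suc j) (length B)))
  B≡ : addFirstColumn (length B ∸ length D) D ≡ B
  B≡ = addFirstColumn-removeFirstColumn B↓ (All.tail (All.++⁻ʳ A ν≥1))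
  core : Core j n A D
  core = record
    { A-sorted   = A↓
    ; A-large    = All.map All.head A≥kB
    ; D-sorted   = removeFirstColumn-sorted B↓
    ; D-positive = removeFirstColumn-positive B
    ; D-small    = removeFirstColumn-≤ B≤k
    ; D-short    = subst₂ _≤_ (+-comm (suc j) (length D)) (sym |A|≡)
                              (+-monoʳ-≤ (suc j) (length-removeFirstColumn B))
    ; weight     = trans (sym (hook-weight j (length B ∸ length D) {A} {B} {D} (sym B≡) |A|≡)) Σν≡n
    }

hookEncode-sound : ∀ j n {A D} → Core j n A D →
                   HookPartition j n (hookEncode j (A , D)) × hookDecode j (hookEncode j (A , D)) ≡ (A , D)
hookEncode-sound j n {A} {D} core =
  ((ν↓ , ν≥1) , trans (hook-weight j c {A} {B} {D} refl |A|≡) weight , A , B , refl , |A|≡) ,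
  trans (hookDecode-++ j {A} {B} |A|≡) (cong (A ,_) (removeFirstColumn-addFirstColumn c D-positive))
  where
  open Core core
  c = length A ∸ suc j ∸ length D
  B = addFirstColumn c D
  |A|≡ : length A ≡ suc j + length B
  |A|≡ = sym (begin
    suc j + length B
      ≡⟨ cong (suc j +_) (length-addFirstColumn c D) ⟩
    suc j + (length D + c)
      ≡⟨ +-assoc (suc j) (length D) c ⟨
    suc j + length D + c
      ≡⟨ cong (suc j + length D +_) (∸-+-assoc (length A) (suc j) (length D)) ⟩
    suc j + length D + (length A ∸ (suc j + length D))
      ≡⟨ m+[n∸m]≡n (subst (_≤ length A) (+-comm (length D) (suc j)) D-short) ⟩
    length A ∎)
  B≤k : All (_≤ suc j) B
  B≤k = addFirstColumn-≤ c D-small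
  ν↓ : Nonincreasing (A ++ suc j ∷ B)
  ν↓ = Nonincreasing-++ (suc j) A-sorted (B≤k ∷ addFirstColumn-sorted c D-sorted) A-large (≤-refl ∷ B≤k)
  ν≥1 : All (1 ≤_) (A ++ suc j ∷ B)
  ν≥1 = All.++⁺ (All.map (≤-trans (s≤s z≤n)) A-large) (s≤s z≤n ∷ addFirstColumn-positive c D)

hookParametrisation : ∀ j n → Parametrisation (hookCondition (suc j) n) (uncurry (Core j n))
hookParametrisation j n = record
  { encode       = hookEncode j
  ; decode       = hookDecode j
  ; decode-sound = hookDecode-sound j n ∘ Equivalence.to (hookCondition⇔ j n _)
  ; encode-sound = λ { {A , D} core → let hook , decode∘encode = hookEncode-sound j n core
                                     in Equivalence.from (hookCondition⇔ j n _) hook , decode∘encode }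
  }

mainTheorem5 : (k n : ℕ) → 1 ≤ k → MSet k n ↔ HookSet k n
mainTheorem5 (suc j) n _ = ↔-byCommonParametrisation (mexParametrisation j n) (hookParametrisation j n)
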